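{- Let $G$ be a permutation graph with a fixed permutation diagram, and let $S$ be a convexly independent set of $G$. If the two points of the border of $\sigma(S)$ are the two endpoints of a single line segment, then this segment is the segment of a vertex of $S$.
   Context: All graphs are finite and simple. A permutation diagram of $G$ represents each vertex by a straight line segment with one endpoint on a top horizontal line and one on a bottom horizontal line (all endpoints distinct); two vertices are adjacent iff their segments cross. A set $C$ of vertices is ($P_3$-)convex if every vertex outside $C$ has at most one neighbor in $C$; $\sigma(A)$ is the smallest convex set containing $A$. A set $S$ is convexly independent if $y\notin\sigma(S\setminus\{y\})$ for all $y\in S$. The border of $\sigma(S)$ is the pair consisting of the rightmost point on the top line and the rightmost point on the bottom line that are endpoints of segments of vertices of $\sigma(S)$. -}

module Defs where

open import Data.Nat using (ℕ; _<_; _≤_)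
open import Data.Fin using (Fin)
open import Data.Fin.Subset using (Subset; _∈_)
open import Data.Product using (Σ; _×_; ∃)
open import Data.Sum using (_⊎_)
open import Relation.Nullary using (¬_)
open import Relation.Binary.PropositionalEquality using (_≡_; _≢_)
open import Function.Definitions using (Injective)
open import Level using (0ℓ; suc)

-- A permutation diagram with n segments (vertices Fin n).
-- top v / bot v : position of the endpoint of segment v on the top / bottom
-- line (a larger number = further right).
record PermDiagram (n : ℕ) : Set where
  field
    top : Fin n → ℕ
    bot : Fin n → ℕ
    top-inj : Injective _≡_ _≡_ top
    bot-inj : Injective _≡_ _≡_ bot

open PermDiagram public

-- The permutation graph of the diagram: adjacent iff segments cross.
Adj : ∀ {n} → PermDiagram n → Fin n → Fin n → Set
Adj D u v = (top D u < top D v × bot D v < bot D u)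
          ⊎ (top D v < top D u × bot D u < bot D v)

-- P3-convexity: every vertex outside C has at most one neighbour in C.
Convex : ∀ {n} → PermDiagram n → (Fin n → Set) → Set
Convex D C = ∀ v → ¬ C v → ∀ u w → Adj D v u → Adj D v w → C u → C w → u ≡ w

σ : ∀ {n} → PermDiagram n → (Fin n → Set) → Fin n → Set₁
σ D A v = (C : _ → Set) → Convex D C → (∀ u → A u → C u) → C v

⟦_⟧ : ∀ {n} → Subset n → Fin n → Set
⟦ S ⟧ v = v ∈ S

_∖_ : ∀ {n} → Subset n → Fin n → Fin n → Set
(S ∖ y) v = v ∈ S × v ≢ y

ConvexlyIndependent : ∀ {n} → PermDiagram n → Subset n → Set₁
ConvexlyIndependent D S = ∀ y → y ∈ S → ¬ σ D (S ∖ y) y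

IsBorder : ∀ {n} → PermDiagram n → Subset n → ℕ → ℕ → Set₁
IsBorder D S t b =
  (Σ _ (λ u → σ D ⟦ S ⟧ u × top D u ≡ t) × (∀ v → σ D ⟦ S ⟧ v → top D v ≤ t))
  × (Σ _ (λ u → σ D ⟦ S ⟧ u × bot D u ≡ b) × (∀ v → σ D ⟦ S ⟧ v → bot D v ≤ b))

-- Suppose x ∉ S. The border segment x crosses no segment of σ(S), since a
-- crossing segment would reach beyond x on the top or the bottom line. Hence
-- x has no neighbour in the convex hull of S, so the hull with x removed is
-- still convex and contains S, contradicting x ∈ σ(S).
--
-- σ quantifies over all convex predicates, so it is not constructively the
-- inductive hull. The bridge is that a vertex of σ(A) outside A already
-- forces double negation elimination, which in turn makes the inductive hull
-- a subset of σ(A).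
module Submission where

open import Defs
open import Axiom.DoubleNegationElimination using (DoubleNegationElimination)
open import Data.Nat using (ℕ; _≤_)
open import Data.Nat.Properties using (<⇒≱)
open import Data.Fin using (Fin; _≟_)
open import Data.Fin.Subset using (Subset; _∈_)
open import Data.Fin.Subset.Properties using (_∈?_)
open import Data.Product using (_×_; _,_; proj₁; proj₂)
open import Data.Sum using (_⊎_; inj₁; inj₂)
open import Data.Empty using (⊥-elim)
open import Level using (0ℓ)
open import Relation.Nullary using (¬_; yes; no)
open import Relation.Unary using (Pred; _⊆_)
open import Relation.Binary.PropositionalEquality using (_≡_; _≢_; refl; subst)

private
  variable
    n : ℕ

data Hull (D : PermDiagram n) (A : Fin n → Set) : Fin n → Set where
  base : ∀ {v} → A v → Hull D A v
  step : ∀ {v u w} → Adj D v u → Adj D v w → u ≢ w →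
         Hull D A u → Hull D A w → Hull D A v

hull-convex : (D : PermDiagram n) (A : Fin n → Set) → Convex D (Hull D A)
hull-convex D A v v∉ u w vu vw u∈ w∈ with u ≟ w
... | yes u≡w = u≡w
... | no u≢w = ⊥-elim (v∉ (step vu vw u≢w u∈ w∈))

hull⊆σ : DoubleNegationElimination 0ℓ → (D : PermDiagram n) (A : Fin n → Set) →
         Hull D A ⊆ σ D A
hull⊆σ _ D A (base a) C C-convex A⊆C = A⊆C _ a
hull⊆σ dne D A (step {u = u} {w} vu vw u≢w u∈ w∈) C C-convex A⊆C =
  dne λ v∉C → u≢w (C-convex _ v∉C u w vu vw
                     (hull⊆σ dne D A u∈ C C-convex A⊆C)
                     (hull⊆σ dne D A w∈ C C-convex A⊆C))

-- The witness is the convex set A ∪ (Hull D A ∩ P): it misses x unless P holds.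
σ-outside⇒dne : (D : PermDiagram n) (A : Fin n → Set) {x : Fin n} →
                ¬ A x → σ D A x → DoubleNegationElimination 0ℓ
σ-outside⇒dne {n} D A x∉A σx {P} ¬¬P with σx C C-convex (λ _ → inj₁)
  where
  C : Fin n → Set
  C y = A y ⊎ (Hull D A y × P)

  C⊆hull : ∀ {y} → C y → Hull D A y
  C⊆hull (inj₁ a) = base a
  C⊆hull (inj₂ (h , _)) = h

  C-convex : Convex D C
  C-convex y y∉C u w yu yw u∈ w∈ with u ≟ w
  ... | yes u≡w = u≡w
  ... | no u≢w = ⊥-elim (¬¬P λ p →
          u≢w (hull-convex D A y (λ h → y∉C (inj₂ (h , p))) u w yu yw
                 (C⊆hull u∈) (C⊆hull w∈)))
... | inj₁ a = ⊥-elim (x∉A a)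
... | inj₂ (_ , p) = p

crossing-free⇒∉σ : (D : PermDiagram n) (A : Fin n → Set) {x : Fin n} → ¬ A x →
                   (∀ z → Hull D A z → ¬ Adj D x z) → ¬ σ D A x
crossing-free⇒∉σ {n} D A {x} x∉A x-isolated σx = proj₂ (σx C C-convex A⊆C) refl
  where
  C : Fin n → Set
  C y = Hull D A y × y ≢ x

  A⊆C : ∀ y → A y → C y
  A⊆C y a = base a , λ { refl → x∉A a }

  C-convex : Convex D C
  C-convex y y∉C u w yu yw u∈ w∈ with y ≟ x
  ... | yes refl = ⊥-elim (x-isolated u (proj₁ u∈) yu)
  ... | no y≢x = hull-convex D A y (λ h → y∉C (h , y≢x)) u w yu yw (proj₁ u∈) (proj₁ w∈)

dominating-segment-crosses-none : ∀ {ℓ} (D : PermDiagram n) (P : Pred (Fin n) ℓ) (x : Fin n) →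
  (∀ v → P v → top D v ≤ top D x) → (∀ v → P v → bot D v ≤ bot D x) →
  ∀ z → P z → ¬ Adj D x z
dominating-segment-crosses-none D P x top≤ bot≤ z Pz (inj₁ (x<z , _)) = <⇒≱ x<z (top≤ z Pz)
dominating-segment-crosses-none D P x top≤ bot≤ z Pz (inj₂ (_ , x<z)) = <⇒≱ x<z (bot≤ z Pz)

mainTheorem7 : ∀ {n} (D : PermDiagram n) (S : Subset n) → ConvexlyIndependent D S →
    (x : Fin n) → IsBorder D S (top D x) (bot D x) → x ∈ S
mainTheorem7 D S _ x (((u , σu , top-u≡top-x) , top≤) , (_ , bot≤)) with x ∈? S
... | yes x∈S = x∈S
... | no x∉S = ⊥-elim (crossing-free⇒∉σ D ⟦ S ⟧ x∉S x-crosses-no-hull-vertex σx)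
  where
  σx : σ D ⟦ S ⟧ x
  σx = subst (σ D ⟦ S ⟧) (top-inj D top-u≡top-x) σu

  x-crosses-no-hull-vertex : ∀ z → Hull D ⟦ S ⟧ z → ¬ Adj D x z
  x-crosses-no-hull-vertex z h = dominating-segment-crosses-none D (σ D ⟦ S ⟧) x top≤ bot≤ z
    (hull⊆σ (σ-outside⇒dne D ⟦ S ⟧ x∉S σx) D ⟦ S ⟧ h)
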